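{- No quiver in the mutation class of $X_7$ has an admissible vector.
   Context: $X_7$ is the quiver with vertices $v_0,v_1,\dots,v_6$ and arrows: double arrows $v_1\Rightarrow v_2$, $v_3\Rightarrow v_4$, $v_5\Rightarrow v_6$, and single arrows $v_0\to v_1$, $v_2\to v_0$, $v_0\to v_3$, $v_4\to v_0$, $v_0\to v_5$, $v_6\to v_0$ (three oriented triangles sharing $v_0$). Quivers have no loops/2-cycles; $b_{ij}$ is the number of arrows $v_i\to v_j$ (negative if reversed); mutation $\mu_k$: $b'_{ij}=-b_{ij}$ if $k\in\{i,j\}$, else $b'_{ij}=b_{ij}+\mathrm{sgn}(b_{ik})[b_{ik}b_{kj}]_+$. For a quiver $Q$ on mutable vertices and $\boldsymbol b$ an integer vector indexed by them, add a frozen vertex $q$ with $b_i$ arrows from $v_i$ to $q$; mutations only at mutable vertices. $\boldsymbol b$ is admissible if $\boldsymbol b\neq0$ and the resulting quiver with frozen vertex has finite mutation class. -}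

module Defs where

open import Data.Nat as ℕ using (ℕ; zero; suc)
open import Data.Integer using (ℤ; +_; -[1+_]; _+_; _-_; _*_; -_; _⊔_)
open import Data.Fin using (Fin; zero; suc; toℕ)
open import Data.Fin.Properties using () renaming (_≟_ to _≟ᶠ_)
open import Data.List using (List)
open import Data.List.Membership.Propositional using ()
open import Data.List.Relation.Unary.Any using (Any)
open import Data.Product using (∃; _×_; _,_)
open import Relation.Nullary using (¬_; yes; no)
open import Relation.Binary.PropositionalEquality using (_≡_)

-- Exchange matrices (quivers) on n vertices: b i j = #arrows i → j (signed).
Mat : ℕ → Set
Mat n = Fin n → Fin n → ℤ

sgn : ℤ → ℤ
sgn (+ zero) = + 0
sgn (+ suc _) = + 1
sgn -[1+ _ ] = - (+ 1)

[_]₊ : ℤ → ℤ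
[ x ]₊ = x ⊔ + 0

μ : ∀ {n} → Fin n → Mat n → Mat n
μ k b i j with i ≟ᶠ k | j ≟ᶠ k
... | yes _ | _     = - b i j
... | no _  | yes _ = - b i j
... | no _  | no _  = b i j + sgn (b i k) * [ b i k * b k j ]₊

data MutEq {n} (b : Mat n) : Mat n → Set where
  here : MutEq b b
  step : ∀ {c} (k : Fin n) → MutEq b c → MutEq b (μ k c)

-- extended quiver: frozen vertex q = zero, mutable vertex v_i = suc i;
-- v_i → q carries bv i arrows.
extend : ∀ {n} → Mat n → (Fin n → ℤ) → Mat (suc n)
extend b bv zero    zero    = + 0
extend b bv (suc i) zero    = bv i
extend b bv zero    (suc j) = - bv j
extend b bv (suc i) (suc j) = b i j

data MutEqFr {n} (b : Mat (suc n)) : Mat (suc n) → Set where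
  here : MutEqFr b b
  step : ∀ {c} (k : Fin n) → MutEqFr b c → MutEqFr b (μ (suc k) c)

_≈ₘ_ : ∀ {n} → Mat n → Mat n → Set
b ≈ₘ c = ∀ i j → b i j ≡ c i j

FiniteMutClassFr : ∀ {n} → Mat (suc n) → Set
FiniteMutClassFr b = ∃ λ (L : List (Mat _)) → ∀ c → MutEqFr b c → Any (c ≈ₘ_) L

Admissible : ∀ {n} → Mat n → (Fin n → ℤ) → Set
Admissible b bv = (¬ (∀ i → bv i ≡ + 0)) × FiniteMutClassFr (extend b bv)

arr : ℕ → ℕ → ℤ
arr 1 2 = + 2
arr 3 4 = + 2
arr 5 6 = + 2
arr 0 1 = + 1
arr 2 0 = + 1
arr 0 3 = + 1
arr 4 0 = + 1
arr 0 5 = + 1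
arr 6 0 = + 1
arr _ _ = + 0

X7 : Mat 7
X7 i j = arr (toℕ i) (toℕ j) - arr (toℕ j) (toℕ i)

-- A double arrow i ⇒ j of the mutable part whose frozen column (x, y) is not of
-- the form (-a, a) with a ≥ 0 forces an infinite mutation class: mutating at the
-- source of the double arrow reverses it, and doing so again and again (or always
-- at the target instead) lowers an entry of the frozen column by at least one
-- each time. For X₇ with a nonzero vector, either one of the three double arrows
-- carries such a column, or mutating at v₀ and at one vertex of each of two
-- other triangles creates a new double arrow (v₂ ⇒ v₅ or v₄ ⇒ v₅) that does,
-- unless the vector vanishes. Mutating the quiver and replacing the vector by the
-- mutated frozen column leaves the frozen mutation class unchanged, which
-- transfers the claim to the whole mutation class of X₇.

module Submission where

open import Defs
import Data.Nat.Properties as ℕP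
open import Algebra.Properties.CommutativeMonoid.Sum ℕP.+-0-commutativeMonoid using (sum; sum-remove)
open import Data.Empty using (⊥-elim)
open import Data.Fin using (Fin; zero; suc)
open import Data.Fin.Patterns using (0F; 1F; 2F; 3F; 4F; 5F; 6F)
open import Data.Fin.Properties using (suc-injective) renaming (_≟_ to _≟ᶠ_)
open import Data.Integer
  using (ℤ; +_; +[1+_]; -[1+_]; _+_; _*_; -_; ∣_∣; 0ℤ; 1ℤ; -1ℤ; _≤_; +≤+; -≤-; -≤+; _≤?_; _≟_)
open import Data.Integer.Properties
open import Data.Integer.Tactic.RingSolver using (solve-∀)
open import Data.List using (List; map)
open import Data.List.Relation.Unary.Any using (Any; here; there)
open import Data.Nat as ℕ using (ℕ; zero; suc)
import Data.Nat.ListAction as ℕL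
open import Data.Product using (∃; ∃₂; _×_; _,_)
open import Data.Sum using (_⊎_; inj₁; inj₂)
open import Function using (_∘_)
open import Relation.Nullary using (¬_; Dec; yes; no)
open import Relation.Nullary.Decidable using (_×-dec_)
open import Relation.Binary.PropositionalEquality

sgn-neg : ∀ x → sgn (- x) ≡ - sgn x
sgn-neg (+ zero) = refl
sgn-neg +[1+ _ ] = refl
sgn-neg -[1+ _ ] = refl

μ-onRow : ∀ {n} {i k : Fin n} (b : Mat n) j → i ≡ k → μ k b i j ≡ - b i j
μ-onRow {i = i} {k} b j i≡k with i ≟ᶠ k
... | yes _   = refl
... | no i≢k  = ⊥-elim (i≢k i≡k)

μ-onColumn : ∀ {n} {j k : Fin n} (b : Mat n) i → j ≡ k → μ k b i j ≡ - b i j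
μ-onColumn {j = j} {k} b i j≡k with i ≟ᶠ k | j ≟ᶠ k
... | yes _ | _      = refl
... | no _  | yes _  = refl
... | no _  | no j≢k = ⊥-elim (j≢k j≡k)

μ-away : ∀ {n} {i j k : Fin n} (b : Mat n) → i ≢ k → j ≢ k →
         μ k b i j ≡ b i j + sgn (b i k) * [ b i k * b k j ]₊
μ-away {i = i} {j} {k} b i≢k j≢k with i ≟ᶠ k | j ≟ᶠ k
... | yes i≡k | _       = ⊥-elim (i≢k i≡k)
... | no _    | yes j≡k = ⊥-elim (j≢k j≡k)
... | no _    | no _    = refl

μ-involutive : ∀ {n} (k : Fin n) (b : Mat n) i j → μ k (μ k b) i j ≡ b i j
μ-involutive k b i j = cases (i ≟ᶠ k) (j ≟ᶠ k)
  where
  open ≡-Reasoning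
  cases : Dec (i ≡ k) → Dec (j ≡ k) → μ k (μ k b) i j ≡ b i j
  cases (yes i≡k) _ = begin
    μ k (μ k b) i j  ≡⟨ μ-onRow (μ k b) j i≡k ⟩
    - μ k b i j      ≡⟨ cong -_ (μ-onRow b j i≡k) ⟩
    - - b i j        ≡⟨ neg-involutive (b i j) ⟩
    b i j            ∎
  cases (no _) (yes j≡k) = begin
    μ k (μ k b) i j  ≡⟨ μ-onColumn (μ k b) i j≡k ⟩
    - μ k b i j      ≡⟨ cong -_ (μ-onColumn b i j≡k) ⟩
    - - b i j        ≡⟨ neg-involutive (b i j) ⟩
    b i j            ∎
  cases (no i≢k) (no j≢k) = begin
    μ k (μ k b) i j
      ≡⟨ μ-away (μ k b) i≢k j≢k ⟩
    μ k b i j + sgn (μ k b i k) * [ μ k b i k * μ k b k j ]₊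
      ≡⟨ cong₂ (λ a c → μ k b i j + sgn a * [ a * c ]₊) (μ-onColumn b i refl) (μ-onRow b j refl) ⟩
    μ k b i j + sgn (- b i k) * [ - b i k * - b k j ]₊
      ≡⟨ cong₂ (λ s c → μ k b i j + s * [ c ]₊) (sgn-neg (b i k)) (neg-*-neg (b i k) (b k j)) ⟩
    μ k b i j + - sgn (b i k) * [ b i k * b k j ]₊
      ≡⟨ cong (_+ - sgn (b i k) * [ b i k * b k j ]₊) (μ-away b i≢k j≢k) ⟩
    b i j + sgn (b i k) * [ b i k * b k j ]₊ + - sgn (b i k) * [ b i k * b k j ]₊
      ≡⟨ add-then-subtract (b i j) (sgn (b i k)) [ b i k * b k j ]₊ ⟩
    b i j ∎
    where
    neg-*-neg : ∀ x y → - x * - y ≡ x * y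
    neg-*-neg = solve-∀
    add-then-subtract : ∀ a s p → a + s * p + - s * p ≡ a
    add-then-subtract = solve-∀

μ-extend : ∀ {n} (M : Mat n) bv (k i j : Fin n) →
           μ (suc k) (extend M bv) (suc i) (suc j) ≡ μ k M i j
μ-extend M bv k i j with i ≟ᶠ k | j ≟ᶠ k
... | yes _ | _     = refl
... | no _  | yes _ = refl
... | no _  | no _  = refl

[]₊-nonneg : ∀ z → 0ℤ ≤ [ z ]₊
[]₊-nonneg z = i≤j⊔i z 0ℤ

≤-+-nonneg : ∀ {d} x → 0ℤ ≤ d → x ≤ x + d
≤-+-nonneg x 0≤d = subst (_≤ x + _) (+-identityʳ x) (+-monoʳ-≤ x 0≤d)

+-nonpos-≤ : ∀ {d} x → d ≤ 0ℤ → x + d ≤ x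
+-nonpos-≤ x d≤0 = subst (x + _ ≤_) (+-identityʳ x) (+-monoʳ-≤ x d≤0)

≤-[1+m]⇒m<∣i∣ : ∀ {i m} → i ≤ -[1+ m ] → m ℕ.< ∣ i ∣
≤-[1+m]⇒m<∣i∣ (-≤- m≤n) = ℕ.s≤s m≤n

≤-1⊎≡0⊎≥1 : ∀ z → z ≤ -1ℤ ⊎ z ≡ 0ℤ ⊎ 1ℤ ≤ z
≤-1⊎≡0⊎≥1 -[1+ _ ] = inj₁ (-≤- ℕ.z≤n)
≤-1⊎≡0⊎≥1 (+ zero) = inj₂ (inj₁ refl)
≤-1⊎≡0⊎≥1 +[1+ _ ] = inj₂ (inj₂ (+≤+ (ℕ.s≤s ℕ.z≤n)))

sum≡0⇒≡neg : ∀ {x y} → x + y ≡ 0ℤ → y ≡ - x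
sum≡0⇒≡neg {x} {y} s≡0 = begin
  y              ≡⟨ regroup x y ⟩
  - x + (x + y)  ≡⟨ cong (_+_ (- x)) s≡0 ⟩
  - x + 0ℤ       ≡⟨ +-identityʳ (- x) ⟩
  - x            ∎
  where
  open ≡-Reasoning
  regroup : ∀ x y → y ≡ - x + (x + y)
  regroup = solve-∀

0≤⇒≡0⊎≥1 : ∀ {z} → 0ℤ ≤ z → z ≡ 0ℤ ⊎ 1ℤ ≤ z
0≤⇒≡0⊎≥1 (+≤+ {n = zero} _)  = inj₁ refl
0≤⇒≡0⊎≥1 (+≤+ {n = suc _} _) = inj₂ (+≤+ (ℕ.s≤s ℕ.z≤n))

nonneg-sum≤0 : ∀ {a b} → 0ℤ ≤ a → 0ℤ ≤ b → a + b ≤ 0ℤ → a ≡ 0ℤ × b ≡ 0ℤ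
nonneg-sum≤0 (+≤+ {n = zero} _)  (+≤+ {n = zero} _)  _         = refl , refl
nonneg-sum≤0 (+≤+ {n = zero} _)  (+≤+ {n = suc _} _) (+≤+ ())
nonneg-sum≤0 (+≤+ {n = suc _} _) (+≤+ _)             (+≤+ ())

nonpos-sum≥0 : ∀ {a b} → a ≤ 0ℤ → b ≤ 0ℤ → 0ℤ ≤ a + b → a ≡ 0ℤ × b ≡ 0ℤ
nonpos-sum≥0 {a} {b} a≤0 b≤0 0≤s
  with nonneg-sum≤0 (neg-mono-≤ a≤0) (neg-mono-≤ b≤0)
                    (subst (_≤ 0ℤ) (neg-distrib-+ a b) (neg-mono-≤ 0≤s))
... | -a≡0 , -b≡0 = neg-injective -a≡0 , neg-injective -b≡0

[]₊-both-zero : ∀ z → [ z ]₊ ≡ 0ℤ → [ - z ]₊ ≡ 0ℤ → z ≡ 0ℤ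
[]₊-both-zero (+ zero)   _  _ = refl
[]₊-both-zero +[1+ _ ]   () _
[]₊-both-zero -[1+ _ ]   _ ()

frozen : ∀ {n} → Mat (suc n) → Fin n → ℤ
frozen E i = E (suc i) zero

frozen-μ-self : ∀ {n} (E : Mat (suc n)) k → frozen (μ (suc k) E) k ≡ - frozen E k
frozen-μ-self E k = μ-onRow E zero refl

frozen-μ : ∀ {n} (E : Mat (suc n)) {i k} → i ≢ k →
           frozen (μ (suc k) E) i
             ≡ frozen E i + sgn (E (suc i) (suc k)) * [ E (suc i) (suc k) * frozen E k ]₊
frozen-μ E i≢k = μ-away E (i≢k ∘ suc-injective) (λ ())

frozen-μ-zero : ∀ {n} (E : Mat (suc n)) k →
                (∀ i → frozen E i ≡ 0ℤ) → ∀ i → frozen (μ (suc k) E) i ≡ 0ℤ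
frozen-μ-zero E k E≡0 i = cases (i ≟ᶠ k)
  where
  open ≡-Reasoning
  a = E (suc i) (suc k)
  cases : Dec (i ≡ k) → frozen (μ (suc k) E) i ≡ 0ℤ
  cases (yes refl) = trans (frozen-μ-self E k) (cong -_ (E≡0 k))
  cases (no i≢k) = begin
    frozen (μ (suc k) E) i                    ≡⟨ frozen-μ E i≢k ⟩
    frozen E i + sgn a * [ a * frozen E k ]₊  ≡⟨ cong₂ (λ u v → u + sgn a * [ a * v ]₊) (E≡0 i) (E≡0 k) ⟩
    0ℤ + sgn a * [ a * 0ℤ ]₊                  ≡⟨ cong (λ t → 0ℤ + sgn a * [ t ]₊) (*-zeroʳ a) ⟩
    0ℤ + sgn a * 0ℤ                           ≡⟨ +-identityˡ _ ⟩
    sgn a * 0ℤ                                ≡⟨ *-zeroʳ (sgn a) ⟩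
    0ℤ                                        ∎

Nonzero : ∀ {n} → (Fin n → ℤ) → Set
Nonzero v = ¬ (∀ i → v i ≡ 0ℤ)

nonzero-μ : ∀ {n} {E : Mat (suc n)} {k} → Nonzero (frozen E) → Nonzero (frozen (μ (suc k) E))
nonzero-μ {E = E} {k} E≢0 μE≡0 =
  E≢0 (λ i → trans (sym (μ-involutive (suc k) E (suc i) zero)) (frozen-μ-zero (μ (suc k) E) k μE≡0 i))

module _ {n} (E : Mat (suc n)) (i k : Fin n) (i≢k : i ≢ k) where

  frozen-μ-out : E (suc i) (suc k) ≡ 1ℤ → frozen (μ (suc k) E) i ≡ frozen E i + [ frozen E k ]₊
  frozen-μ-out i→k = trans (frozen-μ E i≢k) (trans
    (cong (λ a → frozen E i + sgn a * [ a * frozen E k ]₊) i→k)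
    (cong (_+_ (frozen E i)) (trans (*-identityˡ _) (cong [_]₊ (*-identityˡ _)))))

  frozen-μ-in : E (suc i) (suc k) ≡ -1ℤ → frozen (μ (suc k) E) i ≡ frozen E i + - [ - frozen E k ]₊
  frozen-μ-in k→i = trans (frozen-μ E i≢k) (trans
    (cong (λ a → frozen E i + sgn a * [ a * frozen E k ]₊) k→i)
    (cong (_+_ (frozen E i)) (trans (-1*i≡-i _) (cong (λ z → - [ z ]₊) (-1*i≡-i _)))))

  frozen-μ-none : E (suc i) (suc k) ≡ 0ℤ → frozen (μ (suc k) E) i ≡ frozen E i
  frozen-μ-none no-arrow = trans (frozen-μ E i≢k) (trans
    (cong (λ a → frozen E i + sgn a * [ a * frozen E k ]₊) no-arrow)
    (+-identityʳ _))

  frozen-μ-out-≥ : E (suc i) (suc k) ≡ 1ℤ → frozen E i ≤ frozen (μ (suc k) E) i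
  frozen-μ-out-≥ i→k = subst (frozen E i ≤_) (sym (frozen-μ-out i→k)) (≤-+-nonneg _ ([]₊-nonneg _))

  frozen-μ-in-≤ : E (suc i) (suc k) ≡ -1ℤ → frozen (μ (suc k) E) i ≤ frozen E i
  frozen-μ-in-≤ k→i =
    subst (_≤ frozen E i) (sym (frozen-μ-in k→i)) (+-nonpos-≤ _ (neg-mono-≤ ([]₊-nonneg _)))

-- Unbounded frozen columns and infinite mutation classes

MutEqFr-trans : ∀ {n} {E e f : Mat (suc n)} → MutEqFr E e → MutEqFr e f → MutEqFr E f
MutEqFr-trans r here       = r
MutEqFr-trans r (step k s) = step k (MutEqFr-trans r s)

-- Agreement on the rows of the mutable vertices; the frozen row never enters
-- a mutation at a mutable vertex, so this relation is a congruence for those.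
_≃_ : ∀ {n} → Mat (suc n) → Mat (suc n) → Set
E ≃ F = ∀ i j → E (suc i) j ≡ F (suc i) j

μ-resp-≃ : ∀ {n} {E F : Mat (suc n)} k → E ≃ F → μ (suc k) E ≃ μ (suc k) F
μ-resp-≃ {E = E} {F} k E≃F i j with suc i ≟ᶠ suc k | j ≟ᶠ suc k
... | yes _ | _     = cong -_ (E≃F i j)
... | no _  | yes _ = cong -_ (E≃F i j)
... | no _  | no _  =
  cong₂ _+_ (E≃F i j) (cong₂ (λ a c → sgn a * [ a * c ]₊) (E≃F i (suc k)) (E≃F k j))

MutEqFr-transfer : ∀ {n} {E F f : Mat (suc n)} → E ≃ F → MutEqFr F f → ∃ λ e → MutEqFr E e × e ≃ f
MutEqFr-transfer {E = E} E≃F here = E , here , E≃F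
MutEqFr-transfer E≃F (step k r) with MutEqFr-transfer E≃F r
... | e , r′ , e≃f = μ (suc k) e , step k r′ , μ-resp-≃ k e≃f

Unbounded : ∀ {n} → Mat (suc n) → Set
Unbounded E = ∀ N → ∃₂ λ e k → MutEqFr E e × N ℕ.< ∣ frozen e k ∣

unbounded-μ⇒unbounded : ∀ {n} {E : Mat (suc n)} k → Unbounded (μ (suc k) E) → Unbounded E
unbounded-μ⇒unbounded k unbounded N with unbounded N
... | e , i , r , N<e = e , i , MutEqFr-trans (step k here) r , N<e

unbounded-resp-≃ : ∀ {n} {E F : Mat (suc n)} → E ≃ F → Unbounded F → Unbounded E
unbounded-resp-≃ E≃F unbounded N with unbounded N
... | f , i , r , N<f with MutEqFr-transfer E≃F r
... | e , r′ , e≃f = e , i , r′ , subst (λ x → N ℕ.< ∣ x ∣) (sym (e≃f i zero)) N<f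

columnNorm : ∀ {n} → Mat (suc n) → ℕ
columnNorm E = sum (λ i → ∣ frozen E i ∣)

∣frozen∣≤columnNorm : ∀ {n} (E : Mat (suc n)) i → ∣ frozen E i ∣ ℕ.≤ columnNorm E
∣frozen∣≤columnNorm {suc _} E i =
  subst (∣ frozen E i ∣ ℕ.≤_) (sym (sum-remove {i = i} (λ j → ∣ frozen E j ∣))) (ℕP.m≤m+n _ _)

listBound : ∀ {n} → List (Mat (suc n)) → ℕ
listBound L = ℕL.sum (map columnNorm L)

∣frozen∣≤listBound : ∀ {n} {e : Mat (suc n)} {L} →
                     Any (e ≈ₘ_) L → ∀ i → ∣ frozen e i ∣ ℕ.≤ listBound L
∣frozen∣≤listBound (here {m} e≈m) i rewrite e≈m (suc i) zero =
  ℕP.≤-trans (∣frozen∣≤columnNorm m i) (ℕP.m≤m+n _ _)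
∣frozen∣≤listBound (there {m} e∈L) i =
  ℕP.≤-trans (∣frozen∣≤listBound e∈L i) (ℕP.m≤n+m _ (columnNorm m))

unbounded⇒¬finite : ∀ {n} {E : Mat (suc n)} → Unbounded E → ¬ FiniteMutClassFr E
unbounded⇒¬finite unbounded (L , complete) with unbounded (listBound L)
... | e , i , r , bound<e = ℕP.<-irrefl refl (ℕP.<-≤-trans bound<e (∣frozen∣≤listBound (complete e r) i))

module _ {n} (Grows : Mat (suc n) → ℕ → Set)
         (bound : ∀ {E m} → Grows E m → ∃ λ k → m ℕ.< ∣ frozen E k ∣)
         (grow : ∀ {E m} → Grows E m → ∃ λ k → Grows (μ (suc k) E) (suc m)) where

  reachable : ∀ {E} → Grows E 0 → ∀ N → ∃ λ e → MutEqFr E e × Grows e N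
  reachable {E} g zero = E , here , g
  reachable g (suc N) with reachable g N
  ... | e , r , gₑ with grow gₑ
  ...   | k , g′ = μ (suc k) e , step k r , g′

  unbounded-if-growing : ∀ {E} → Grows E 0 → Unbounded E
  unbounded-if-growing g N with reachable g N
  ... | e , r , gₑ with bound gₑ
  ...   | k , N<e = e , k , r , N<e

unbounded-along-MutEq : ∀ {n} {b Q : Mat n} → (∀ v → Nonzero v → Unbounded (extend b v)) →
                        MutEq b Q → ∀ v → Nonzero v → Unbounded (extend Q v)
unbounded-along-MutEq unbounded here = unbounded
unbounded-along-MutEq unbounded (step {c} k r) v v≢0 =
  unbounded-μ⇒unbounded k
    (unbounded-resp-≃ back (unbounded-along-MutEq unbounded r (frozen E) (nonzero-μ v≢0)))
  where
  E = μ (suc k) (extend (μ k c) v)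
  back : E ≃ extend c (frozen E)
  back i zero    = refl
  back i (suc j) = trans (μ-extend (μ k c) v k i j) (μ-involutive k c i j)

-- Kronecker pairs

record Kronecker {n} (E : Mat (suc n)) (i j : Fin n) : Set where
  constructor kronecker
  field
    double     : E (suc i) (suc j) ≡ + 2
    double-rev : E (suc j) (suc i) ≡ -[1+ 1 ]
open Kronecker

Kronecker-irreflexive : ∀ {n} {E : Mat (suc n)} {i j} → Kronecker E i j → i ≢ j
Kronecker-irreflexive (kronecker i→j j→i) refl with trans (sym i→j) j→i
... | ()

module _ {n} {E : Mat (suc n)} {i j : Fin n} (kr : Kronecker E i j) where
  private
    x y : ℤ
    x = frozen E i
    y = frozen E j
    i≢j : i ≢ j
    i≢j = Kronecker-irreflexive kr

  Kronecker-μ-source : Kronecker (μ (suc i) E) j i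
  Kronecker-μ-source = kronecker (trans (μ-onColumn E (suc j) refl) (cong -_ (double-rev kr)))
                                 (trans (μ-onRow E (suc j) refl) (cong -_ (double kr)))

  Kronecker-μ-target : Kronecker (μ (suc j) E) j i
  Kronecker-μ-target = kronecker (trans (μ-onRow E (suc i) refl) (cong -_ (double-rev kr)))
                                 (trans (μ-onColumn E (suc i) refl) (cong -_ (double kr)))

  frozen-μ-source : frozen (μ (suc i) E) j ≡ y + - [ -[1+ 1 ] * x ]₊
  frozen-μ-source = begin
    frozen (μ (suc i) E) j                    ≡⟨ frozen-μ E (≢-sym i≢j) ⟩
    y + sgn a * [ a * x ]₊                    ≡⟨ cong (λ a → y + sgn a * [ a * x ]₊) (double-rev kr) ⟩
    y + -1ℤ * [ -[1+ 1 ] * x ]₊               ≡⟨ cong (_+_ y) (-1*i≡-i _) ⟩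
    y + - [ -[1+ 1 ] * x ]₊                   ∎
    where
    open ≡-Reasoning
    a = E (suc j) (suc i)

  frozen-μ-target : frozen (μ (suc j) E) i ≡ x + [ + 2 * y ]₊
  frozen-μ-target = begin
    frozen (μ (suc j) E) i                    ≡⟨ frozen-μ E i≢j ⟩
    x + sgn a * [ a * y ]₊                    ≡⟨ cong (λ a → x + sgn a * [ a * y ]₊) (double kr) ⟩
    x + 1ℤ * [ + 2 * y ]₊                     ≡⟨ cong (_+_ x) (*-identityˡ _) ⟩
    x + [ + 2 * y ]₊                          ∎
    where
    open ≡-Reasoning
    a = E (suc i) (suc j)

  frozen-μ-source-≤ : frozen (μ (suc i) E) j ≤ y
  frozen-μ-source-≤ = subst (_≤ y) (sym frozen-μ-source) (+-nonpos-≤ y (neg-mono-≤ ([]₊-nonneg _)))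

  frozen-μ-source-≤′ : frozen (μ (suc i) E) j ≤ (x + y) + x
  frozen-μ-source-≤′ = begin
    frozen (μ (suc i) E) j       ≡⟨ frozen-μ-source ⟩
    y + - [ -[1+ 1 ] * x ]₊      ≤⟨ +-monoʳ-≤ y (neg-mono-≤ (i≤i⊔j _ 0ℤ)) ⟩
    y + - (-[1+ 1 ] * x)         ≡⟨ twice x y ⟩
    (x + y) + x                  ∎
    where
    open ≤-Reasoning
    twice : ∀ x y → y + - (-[1+ 1 ] * x) ≡ (x + y) + x
    twice = solve-∀

  frozen-μ-source-sum : frozen (μ (suc i) E) j + frozen (μ (suc i) E) i ≤ x + y
  frozen-μ-source-sum = begin
    frozen (μ (suc i) E) j + frozen (μ (suc i) E) i
      ≡⟨ cong (_+_ (frozen (μ (suc i) E) j)) (frozen-μ-self E i) ⟩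
    frozen (μ (suc i) E) j + - x
      ≤⟨ +-monoˡ-≤ (- x) frozen-μ-source-≤′ ⟩
    (x + y) + x + - x
      ≡⟨ cancel x y ⟩
    x + y ∎
    where
    open ≤-Reasoning
    cancel : ∀ x y → (x + y) + x + - x ≡ x + y
    cancel = solve-∀

  frozen-μ-target-≥ : x ≤ frozen (μ (suc j) E) i
  frozen-μ-target-≥ = subst (x ≤_) (sym frozen-μ-target) (≤-+-nonneg x ([]₊-nonneg _))

  frozen-μ-target-sum : x + y ≤ frozen (μ (suc j) E) j + frozen (μ (suc j) E) i
  frozen-μ-target-sum = begin
    x + y                                            ≡⟨ cancel x y ⟩
    - y + (x + + 2 * y)                              ≤⟨ +-monoʳ-≤ (- y) (+-monoʳ-≤ x (i≤i⊔j _ 0ℤ)) ⟩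
    - y + (x + [ + 2 * y ]₊)                         ≡⟨ sym (cong₂ _+_ (frozen-μ-self E j) frozen-μ-target) ⟩
    frozen (μ (suc j) E) j + frozen (μ (suc j) E) i  ∎
    where
    open ≤-Reasoning
    cancel : ∀ x y → x + y ≡ - y + (x + + 2 * y)
    cancel = solve-∀

KroneckerRun : ∀ {n} → (ℤ → Set) → Mat (suc n) → ℕ → Set
KroneckerRun S E m = ∃₂ λ i j → Kronecker E i j × frozen E i ≤ -[1+ m ] × S (frozen E i + frozen E j)

Descending Ascending : ∀ {n} → Mat (suc n) → ℕ → Set
Descending = KroneckerRun (_≤ -1ℤ)
Ascending  = KroneckerRun (1ℤ ≤_)

KroneckerRun-bound : ∀ {n} {S} {E : Mat (suc n)} {m} →
                     KroneckerRun S E m → ∃ λ k → m ℕ.< ∣ frozen E k ∣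
KroneckerRun-bound (i , _ , _ , x≤ , _) = i , ≤-[1+m]⇒m<∣i∣ x≤

descending-step : ∀ {n} {E : Mat (suc n)} {m} → Descending E m → ∃ λ k → Descending (μ (suc k) E) (suc m)
descending-step (i , j , kr , x≤ , s≤) =
  i , j , i , Kronecker-μ-source kr , ≤-trans (frozen-μ-source-≤′ kr) (+-mono-≤ s≤ x≤)
            , ≤-trans (frozen-μ-source-sum kr) s≤

ascending-step : ∀ {n} {E : Mat (suc n)} {m} → Ascending E m → ∃ λ k → Ascending (μ (suc k) E) (suc m)
ascending-step {E = E} {m} (i , j , kr , x≤ , 1≤s) =
  j , j , i , Kronecker-μ-target kr , x′≤ , ≤-trans 1≤s (frozen-μ-target-sum kr)
  where
  open ≤-Reasoning
  split : ∀ x y → - y ≡ - (x + y) + x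
  split = solve-∀
  x′≤ : frozen (μ (suc j) E) j ≤ -[1+ suc m ]
  x′≤ = begin
    frozen (μ (suc j) E) j                    ≡⟨ frozen-μ-self E j ⟩
    - frozen E j                              ≡⟨ split (frozen E i) (frozen E j) ⟩
    - (frozen E i + frozen E j) + frozen E i  ≤⟨ +-mono-≤ (neg-mono-≤ 1≤s) x≤ ⟩
    -[1+ suc m ]                              ∎

descending-unbounded : ∀ {n} {E : Mat (suc n)} → Descending E 0 → Unbounded E
descending-unbounded = unbounded-if-growing Descending (KroneckerRun-bound {S = _≤ -1ℤ}) descending-step

ascending-unbounded : ∀ {n} {E : Mat (suc n)} → Ascending E 0 → Unbounded E
ascending-unbounded = unbounded-if-growing Ascending (KroneckerRun-bound {S = 1ℤ ≤_}) ascending-step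

descending-after-source : ∀ {n} {E : Mat (suc n)} {i j} → Kronecker E i j →
                          0ℤ ≤ frozen E i → frozen E j ≤ -1ℤ → Descending (μ (suc i) E) 0
descending-after-source {E = E} {i} {j} kr 0≤x y≤-1 =
  j , i , Kronecker-μ-source kr , ≤-trans (frozen-μ-source-≤ kr) y≤-1 , s′≤
  where
  open ≤-Reasoning
  s′≤ : frozen (μ (suc i) E) j + frozen (μ (suc i) E) i ≤ -1ℤ
  s′≤ = begin
    frozen (μ (suc i) E) j + frozen (μ (suc i) E) i  ≡⟨ cong (_+_ (frozen (μ (suc i) E) j)) (frozen-μ-self E i) ⟩
    frozen (μ (suc i) E) j + - frozen E i            ≤⟨ +-nonpos-≤ _ (neg-mono-≤ 0≤x) ⟩
    frozen (μ (suc i) E) j                           ≤⟨ frozen-μ-source-≤ kr ⟩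
    frozen E j                                       ≤⟨ y≤-1 ⟩
    -1ℤ                                              ∎

ascending-after-target : ∀ {n} {E : Mat (suc n)} {i j} → Kronecker E i j →
                         0ℤ ≤ frozen E i → 1ℤ ≤ frozen E j → Ascending (μ (suc j) E) 0
ascending-after-target {E = E} {i} {j} kr 0≤x 1≤y =
  j , i , Kronecker-μ-target kr
    , subst (_≤ -1ℤ) (sym (frozen-μ-self E j)) (neg-mono-≤ 1≤y)
    , ≤-trans (+-mono-≤ 0≤x 1≤y) (frozen-μ-target-sum kr)

-- Balanced columns (-a, a), a ≥ 0, are preserved by mutation at either end of the
-- pair; they are the only ones a Kronecker pair cannot drive to infinity.
Balanced : ℤ → ℤ → Set
Balanced x y = x ≤ 0ℤ × x + y ≡ 0ℤ

kronecker-unbounded-nonneg : ∀ {n} {E : Mat (suc n)} {i j} → Kronecker E i j →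
  0ℤ ≤ frozen E i → (frozen E j ≡ 0ℤ → 1ℤ ≤ frozen E i) → Unbounded E
kronecker-unbounded-nonneg {E = E} {i} {j} kr 0≤x y≡0⇒1≤x with ≤-1⊎≡0⊎≥1 (frozen E j)
... | inj₁ y≤-1        = unbounded-μ⇒unbounded i (descending-unbounded (descending-after-source kr 0≤x y≤-1))
... | inj₂ (inj₂ 1≤y)  = unbounded-μ⇒unbounded j (ascending-unbounded (ascending-after-target kr 0≤x 1≤y))
... | inj₂ (inj₁ y≡0)  = unbounded-μ⇒unbounded j (unbounded-μ⇒unbounded i
  (ascending-unbounded (ascending-after-target (Kronecker-μ-target kr) 0≤x′ 1≤y′)))
  where
  0≤x′ : 0ℤ ≤ frozen (μ (suc j) E) j
  0≤x′ = ≤-reflexive (sym (trans (frozen-μ-self E j) (cong -_ y≡0)))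
  1≤y′ : 1ℤ ≤ frozen (μ (suc j) E) i
  1≤y′ = ≤-trans (y≡0⇒1≤x y≡0) (frozen-μ-target-≥ kr)

kronecker-unbounded : ∀ {n} {E : Mat (suc n)} {i j} → Kronecker E i j →
                      ¬ Balanced (frozen E i) (frozen E j) → Unbounded E
kronecker-unbounded {E = E} {i} {j} kr unbalanced with ≤-1⊎≡0⊎≥1 (frozen E i)
... | inj₁ x≤-1 with ≤-1⊎≡0⊎≥1 (frozen E i + frozen E j)
...   | inj₁ s≤-1       = descending-unbounded (i , j , kr , x≤-1 , s≤-1)
...   | inj₂ (inj₁ s≡0) = ⊥-elim (unbalanced (≤-trans x≤-1 -≤+ , s≡0))
...   | inj₂ (inj₂ 1≤s) = ascending-unbounded (i , j , kr , x≤-1 , 1≤s)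
kronecker-unbounded kr unbalanced | inj₂ (inj₁ x≡0) =
  kronecker-unbounded-nonneg kr (≤-reflexive (sym x≡0))
    (λ y≡0 → ⊥-elim (unbalanced (≤-reflexive x≡0 , cong₂ _+_ x≡0 y≡0)))
kronecker-unbounded kr unbalanced | inj₂ (inj₂ 1≤x) =
  kronecker-unbounded-nonneg kr (≤-trans (+≤+ ℕ.z≤n) 1≤x) (λ _ → 1≤x)

balanced? : ∀ x y → Dec (Balanced x y)
balanced? x y = (x ≤? 0ℤ) ×-dec (x + y ≟ 0ℤ)

balanced-nonneg : ∀ {x y} → Balanced x y → 0ℤ ≤ y
balanced-nonneg (x≤0 , s≡0) = subst (0ℤ ≤_) (sym (sum≡0⇒≡neg s≡0)) (neg-mono-≤ x≤0)

-- The quiver X₇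

module _ (w : Fin 7 → ℤ) where

  E₀ μ₀E₀ T S : Mat 8
  E₀   = extend X7 w
  μ₀E₀ = μ (suc 0F) E₀
  T    = μ (suc 4F) (μ (suc 3F) μ₀E₀)
  S    = μ (suc 2F) (μ (suc 1F) μ₀E₀)

  unbounded-if-w₂-positive : 1ℤ ≤ w 2F → Unbounded E₀
  unbounded-if-w₂-positive 1≤w₂ =
    unbounded-μ⇒unbounded 0F (unbounded-μ⇒unbounded 3F (unbounded-μ⇒unbounded 4F
      (kronecker-unbounded (kronecker {E = T} {2F} {5F} refl refl) unbalanced)))
    where
    open ≤-Reasoning
    w₂≤ : w 2F ≤ frozen T 2F
    w₂≤ = begin
      w 2F                            ≤⟨ frozen-μ-out-≥ E₀ 2F 0F (λ ()) refl ⟩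
      frozen μ₀E₀ 2F                  ≤⟨ frozen-μ-out-≥ μ₀E₀ 2F 3F (λ ()) refl ⟩
      frozen (μ (suc 3F) μ₀E₀) 2F     ≤⟨ frozen-μ-out-≥ (μ (suc 3F) μ₀E₀) 2F 4F (λ ()) refl ⟩
      frozen T 2F                     ∎
    unbalanced : ¬ Balanced (frozen T 2F) (frozen T 5F)
    unbalanced (x≤0 , _) with ≤-trans (≤-trans 1≤w₂ w₂≤) x≤0
    ... | +≤+ ()

  zero-if-bounded : Balanced (w 1F) (w 2F) → Balanced (w 3F) (w 4F) → Balanced (w 5F) (w 6F) → w 2F ≡ 0ℤ →
                    w 4F + [ w 0F ]₊ ≤ 0ℤ → 0ℤ ≤ w 5F + - [ - w 0F ]₊ → ∀ i → w i ≡ 0ℤ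
  zero-if-bounded (_ , s₁₂) b₃₄@(_ , s₃₄) (w₅≤0 , s₅₆) w₂≡0 lower≤0 0≤upper
    with nonneg-sum≤0 (balanced-nonneg b₃₄) ([]₊-nonneg (w 0F)) lower≤0
       | nonpos-sum≥0 w₅≤0 (neg-mono-≤ ([]₊-nonneg (- w 0F))) 0≤upper
  ... | w₄≡0 , [w₀]₊≡0 | w₅≡0 , -[-w₀]₊≡0 = λ where
    0F → []₊-both-zero (w 0F) [w₀]₊≡0 (neg-injective -[-w₀]₊≡0)
    1F → trans (sum≡0⇒≡neg (trans (+-comm (w 2F) (w 1F)) s₁₂)) (cong -_ w₂≡0)
    2F → w₂≡0
    3F → trans (sum≡0⇒≡neg (trans (+-comm (w 4F) (w 3F)) s₃₄)) (cong -_ w₄≡0)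
    4F → w₄≡0
    5F → w₅≡0
    6F → trans (sum≡0⇒≡neg s₅₆) (cong -_ w₅≡0)

  unbounded-if-w₂-zero : Balanced (w 1F) (w 2F) → Balanced (w 3F) (w 4F) → Balanced (w 5F) (w 6F) →
                         w 2F ≡ 0ℤ → Nonzero w → Unbounded E₀
  unbounded-if-w₂-zero b₁₂ b₃₄ b₅₆ w₂≡0 w≢0 =
    unbounded-μ⇒unbounded 0F (unbounded-μ⇒unbounded 1F (unbounded-μ⇒unbounded 2F
      (kronecker-unbounded (kronecker {E = S} {4F} {5F} refl refl) unbalanced)))
    where
    open ≤-Reasoning
    lower : w 4F + [ w 0F ]₊ ≤ frozen S 4F
    lower = begin
      w 4F + [ w 0F ]₊                ≡⟨ sym (frozen-μ-out E₀ 4F 0F (λ ()) refl) ⟩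
      frozen μ₀E₀ 4F                  ≤⟨ frozen-μ-out-≥ μ₀E₀ 4F 1F (λ ()) refl ⟩
      frozen (μ (suc 1F) μ₀E₀) 4F     ≤⟨ frozen-μ-out-≥ (μ (suc 1F) μ₀E₀) 4F 2F (λ ()) refl ⟩
      frozen S 4F                     ∎
    upper : frozen S 5F ≤ w 5F + - [ - w 0F ]₊
    upper = begin
      frozen S 5F                     ≤⟨ frozen-μ-in-≤ (μ (suc 1F) μ₀E₀) 5F 2F (λ ()) refl ⟩
      frozen (μ (suc 1F) μ₀E₀) 5F     ≡⟨ frozen-μ-none μ₀E₀ 5F 1F (λ ()) refl ⟩
      frozen μ₀E₀ 5F                  ≡⟨ frozen-μ-in E₀ 5F 0F (λ ()) refl ⟩
      w 5F + - [ - w 0F ]₊            ∎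
    unbalanced : ¬ Balanced (frozen S 4F) (frozen S 5F)
    unbalanced bₛ@(x≤0 , _) = w≢0 (zero-if-bounded b₁₂ b₃₄ b₅₆ w₂≡0
      (≤-trans lower x≤0) (≤-trans (balanced-nonneg bₛ) upper))

X7-unbounded : ∀ w → Nonzero w → Unbounded (extend X7 w)
X7-unbounded w w≢0 with balanced? (w 1F) (w 2F) | balanced? (w 3F) (w 4F) | balanced? (w 5F) (w 6F)
... | no ¬b₁₂ | _       | _       = kronecker-unbounded (kronecker {i = 1F} {2F} refl refl) ¬b₁₂
... | yes _   | no ¬b₃₄ | _       = kronecker-unbounded (kronecker {i = 3F} {4F} refl refl) ¬b₃₄
... | yes _   | yes _   | no ¬b₅₆ = kronecker-unbounded (kronecker {i = 5F} {6F} refl refl) ¬b₅₆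
... | yes b₁₂ | yes b₃₄ | yes b₅₆ with 0≤⇒≡0⊎≥1 (balanced-nonneg b₁₂)
...   | inj₁ w₂≡0 = unbounded-if-w₂-zero w b₁₂ b₃₄ b₅₆ w₂≡0 w≢0
...   | inj₂ 1≤w₂ = unbounded-if-w₂-positive w 1≤w₂

theorem6p1 : ∀ (Q : Mat 7) → MutEq X7 Q → ∀ (bv : Fin 7 → ℤ) → ¬ Admissible Q bv
theorem6p1 Q r bv (bv≢0 , finite) =
  unbounded⇒¬finite (unbounded-along-MutEq X7-unbounded r bv bv≢0) finite
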